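{- Let $p$ be a prime and $B>0$. For any integers $j,b$ with $b\in\Psi_B$, $1\leqslant j\leqslant p^{l_p}b$ and $\gcd(j,p)=1$, we have $\frac{j}{p^{l_p}b}\in\mathcal{Z}_B$.
   Context: $l_p=1$ if $p\geqslant5$, $2$ if $p=3$, $3$ if $p=2$. $\varphi$ is Euler's totient function, $\Psi_B:=\{b\in\mathbb{N}\mid\varphi(p^{l_p}b)\leqslant B\}$ and $\mathcal{Z}_B:=\{\frac{a}{p^{l_p}b}\mid b\in\Psi_B,\ 1\leqslant a\leqslant p^{l_p}b,\ \gcd(a,p^{l_p}b)=1\}$. -}

module Defs where

open import Data.Nat using (ℕ; zero; suc; _+_; _*_; _^_; _≤_)
open import Data.Nat.GCD using (gcd)
open import Data.Nat.Properties using (_≟_)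
open import Data.List using (List; length; filter; upTo; map)
open import Data.Integer using (+_)
open import Data.Rational using (ℚ; _/_; 0ℚ)
open import Data.Product using (Σ; _×_)
open import Relation.Binary.PropositionalEquality using (_≡_)

lp : ℕ → ℕ
lp 2 = 3
lp 3 = 2
lp _ = 1

φ : ℕ → ℕ
φ n = length (filter (λ k → gcd k n ≟ 1) (map suc (upTo n)))

-- the rational number a / d (only used with d ≥ 1; d = 0 gives 0)
frac : ℕ → ℕ → ℚ
frac a zero = 0ℚ
frac a (suc d) = (+ a) / suc d

Ψ : ℕ → ℕ → ℕ → Set
Ψ p B b = (1 ≤ b) × (φ (p ^ lp p * b) ≤ B)

_∈𝒵[_,_] : ℚ → ℕ → ℕ → Set
x ∈𝒵[ p , B ] = Σ ℕ λ b → Σ ℕ λ a →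
  Ψ p B b × (1 ≤ a) × (a ≤ p ^ lp p * b) × (gcd a (p ^ lp p * b) ≡ 1)
  × (x ≡ frac a (p ^ lp p * b))

-- Write g = gcd(j, p^{l_p} b). Since j is prime to p, g is prime to p^{l_p}, hence g divides b,
-- and j / (p^{l_p} b) is the reduced fraction (j/g) / (p^{l_p} (b/g)). This is an element of 𝒵_B
-- because b/g ∈ Ψ_B: Euler's totient is monotone along multiples, φ(m) ≤ φ(m g) for g ≥ 1.
-- By prime factorisation of g it suffices to treat g = q prime, and there each totative x of m
-- gives a totative of m q among x and m + x (both ≤ 2m ≤ m q).
module Submission where

open import Defs
open import Data.Nat using (ℕ; _*_; _^_; _≤_; _<_)
open import Data.Nat.GCD using (gcd)
open import Data.Nat.Primality using (Prime)
open import Relation.Binary.PropositionalEquality using (_≡_)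

open import Level using (Level)
open import Data.Nat.Base
  using (zero; suc; _+_; _∸_; z≤n; s≤s; NonZero; ≢-nonZero; >-nonZero; nonTrivial⇒≢1; nonTrivial⇒n>1)
open import Data.Nat.Properties
open import Data.Nat.Divisibility using (_∣_; _∣?_; ∣-trans; ∣m+n∣m⇒∣n; ∣1⇒≡1; ∣⇒≤)
open import Data.Nat.DivMod using (_/_; m/n*n≡m; *-/-assoc; /-monoˡ-≤; m≥n⇒m/n>0)
open import Data.Nat.GCD using (gcd[m,n]∣m; gcd[m,n]∣n; gcd[m,n]≢0)
open import Data.Nat.Coprimality
  using (Coprime; coprime⇒gcd≡1; gcd≡1⇒coprime; coprime-divisor; coprime-+; coprime-/gcd)
open import Data.Nat.Primality using (prime⇒irreducible; prime⇒nonTrivial)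
open import Data.Nat.Primality.Factorisation using (factorise; PrimeFactorisation)
open import Data.List.Base using (List; []; _∷_; _++_; length; filter; applyUpTo)
open import Data.Nat.ListAction using (product)
open import Data.List.Properties using (map-upTo; filter-++; length-++; filter-accept)
open import Function.Base using (_∘_)
open import Data.List.Relation.Unary.All using (All; []; _∷_)
open import Data.Product using (_,_)
open import Data.Sum using (_⊎_; inj₁; inj₂)
open import Data.Integer using (+_)
import Data.Integer as ℤ
open import Data.Integer.Properties using (pos-*)
open import Data.Rational.Properties using (fromℚᵘ-cong)
open import Data.Rational.Unnormalised using (mkℚᵘ; *≡*)
open import Relation.Nullary using (¬_; yes; no)
open import Relation.Nullary.Negation using (contradiction)
open import Relation.Unary using (Pred; Decidable)
open import Relation.Binary.PropositionalEquality using (refl; sym; trans; cong; cong₂; subst; module ≡-Reasoning)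

private variable
  a ℓ : Level
  A : Set a

applyUpTo-+ : ∀ (f : ℕ → A) m n → applyUpTo f (m + n) ≡ applyUpTo f m ++ applyUpTo (λ k → f (m + k)) n
applyUpTo-+ f zero    n = refl
applyUpTo-+ f (suc m) n = cong (f 0 ∷_) (applyUpTo-+ (f ∘ suc) m n)

module _ {Q : Pred A ℓ} (Q? : Decidable Q) where

  length-filter-++ : ∀ xs ys → length (filter Q? (xs ++ ys)) ≡ length (filter Q? xs) + length (filter Q? ys)
  length-filter-++ xs ys = trans (cong length (filter-++ Q? xs ys)) (length-++ (filter Q? xs))

  length-filter-∷ : ∀ x xs → length (filter Q? xs) ≤ length (filter Q? (x ∷ xs))
  length-filter-∷ x xs with Q? x
  ... | yes _ = n≤1+n _
  ... | no  _ = ≤-refl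

  length-filter-applyUpTo-mono : ∀ (f : ℕ → A) {m n} → m ≤ n →
    length (filter Q? (applyUpTo f m)) ≤ length (filter Q? (applyUpTo f n))
  length-filter-applyUpTo-mono f {m} {n} m≤n = begin
    length (filter Q? (applyUpTo f m))
      ≤⟨ m≤m+n _ _ ⟩
    length (filter Q? (applyUpTo f m)) + length (filter Q? (applyUpTo (λ k → f (m + k)) (n ∸ m)))
      ≡⟨ length-filter-++ (applyUpTo f m) _ ⟨
    length (filter Q? (applyUpTo f m ++ applyUpTo (λ k → f (m + k)) (n ∸ m)))
      ≡⟨ cong (λ l → length (filter Q? l)) (applyUpTo-+ f m (n ∸ m)) ⟨
    length (filter Q? (applyUpTo f (m + (n ∸ m))))
      ≡⟨ cong (λ k → length (filter Q? (applyUpTo f k))) (m+[n∸m]≡n m≤n) ⟩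
    length (filter Q? (applyUpTo f n))
      ∎
    where open ≤-Reasoning

module _ {P Q : Pred A ℓ} (P? : Decidable P) (Q? : Decidable Q) where

  module _ (x y : A) (xs ys : List A) where
    private
      LP  = length (filter P? xs)
      LQx = length (filter Q? xs)
      LQy = length (filter Q? ys)
      LQx′ = length (filter Q? (x ∷ xs))
      LQy′ = length (filter Q? (y ∷ ys))

    length-filter-∷-≤-cover : (P x → Q x ⊎ Q y) → LP ≤ LQx + LQy →
                              length (filter P? (x ∷ xs)) ≤ LQx′ + LQy′
    length-filter-∷-≤-cover cover ih with P? x
    ... | no _ = ≤-trans ih (+-mono-≤ (length-filter-∷ Q? x xs) (length-filter-∷ Q? y ys))
    ... | yes Px with cover Px
    ...   | inj₁ Qx = begin
      suc LP              ≤⟨ s≤s ih ⟩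
      suc (LQx + LQy)     ≤⟨ s≤s (+-monoʳ-≤ LQx (length-filter-∷ Q? y ys)) ⟩
      suc LQx + LQy′      ≡⟨ cong (λ l → length l + LQy′) (filter-accept Q? Qx) ⟨
      LQx′ + LQy′         ∎
      where open ≤-Reasoning
    ...   | inj₂ Qy = begin
      suc LP              ≤⟨ s≤s ih ⟩
      suc (LQx + LQy)     ≡⟨ +-suc LQx LQy ⟨
      LQx + suc LQy       ≤⟨ +-monoˡ-≤ (suc LQy) (length-filter-∷ Q? x xs) ⟩
      LQx′ + suc LQy      ≡⟨ cong (λ l → LQx′ + length l) (filter-accept Q? Qy) ⟨
      LQx′ + LQy′         ∎
      where open ≤-Reasoning

  length-filter-applyUpTo-≤-cover : ∀ (f g : ℕ → A) → (∀ k → P (f k) → Q (f k) ⊎ Q (g k)) →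
    ∀ n → length (filter P? (applyUpTo f n))
          ≤ length (filter Q? (applyUpTo f n)) + length (filter Q? (applyUpTo g n))
  length-filter-applyUpTo-≤-cover f g cover zero = z≤n
  length-filter-applyUpTo-≤-cover f g cover (suc n) =
    length-filter-∷-≤-cover (f 0) (g 0) (applyUpTo (f ∘ suc) n) (applyUpTo (g ∘ suc) n) (cover 0)
      (length-filter-applyUpTo-≤-cover (f ∘ suc) (g ∘ suc) (cover ∘ suc) n)

coprimeTo? : ∀ n → Decidable (λ k → gcd k n ≡ 1)
coprimeTo? n k = gcd k n ≟ 1

φ≡length-filter-coprimeTo : ∀ n → φ n ≡ length (filter (coprimeTo? n) (applyUpTo suc n))
φ≡length-filter-coprimeTo n = cong (λ l → length (filter (coprimeTo? n) l)) (map-upTo suc n)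

∣∧coprime⇒coprime : ∀ {d x n} → d ∣ x → Coprime x n → Coprime d n
∣∧coprime⇒coprime d∣x c (e∣d , e∣n) = c (∣-trans e∣d d∣x , e∣n)

coprime-* : ∀ {x m n} → Coprime x m → Coprime x n → Coprime x (m * n)
coprime-* c[x,m] c[x,n] (d∣x , d∣mn) =
  c[x,n] (d∣x , coprime-divisor (∣∧coprime⇒coprime d∣x c[x,m]) d∣mn)

coprime-^ : ∀ {x n} k → Coprime x n → Coprime x (n ^ k)
coprime-^ zero    c (_ , d∣1) = ∣1⇒≡1 d∣1
coprime-^ (suc k) c = coprime-* c (coprime-^ k c)

prime∤⇒coprime : ∀ {q x} → Prime q → ¬ q ∣ x → Coprime x q
prime∤⇒coprime q-prime q∤x {d} (d∣x , d∣q) with prime⇒irreducible q-prime d∣q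
... | inj₁ d≡1 = d≡1
... | inj₂ refl = contradiction d∣x q∤x

-- If q ∣ x then q ∤ m + x, for otherwise q ∣ gcd(m, x) = 1.
coprime⇒coprime-*-prime : ∀ {q m x} → Prime q → Coprime x m →
                          Coprime x (m * q) ⊎ Coprime (m + x) (m * q)
coprime⇒coprime-*-prime {q} {m} {x} q-prime c[x,m] with q ∣? x
... | no  q∤x = inj₁ (coprime-* c[x,m] (prime∤⇒coprime q-prime q∤x))
... | yes q∣x = inj₂ (coprime-* (coprime-+ c[x,m]) (prime∤⇒coprime q-prime q∤m+x))
  where
  q∤m+x : ¬ q ∣ m + x
  q∤m+x q∣m+x = nonTrivial⇒≢1 {{prime⇒nonTrivial q-prime}}
    (c[x,m] (q∣x , ∣m+n∣m⇒∣n (subst (q ∣_) (+-comm m x) q∣m+x) q∣x))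

φ-*-prime : ∀ {q} → Prime q → ∀ m → φ m ≤ φ (m * q)
φ-*-prime {q} q-prime m = begin
  φ m
    ≡⟨ φ≡length-filter-coprimeTo m ⟩
  length (filter (coprimeTo? m) (applyUpTo suc m))
    ≤⟨ length-filter-applyUpTo-≤-cover (coprimeTo? m) (coprimeTo? mq) suc (λ k → suc (m + k)) cover m ⟩
  length (filter (coprimeTo? mq) (applyUpTo suc m))
    + length (filter (coprimeTo? mq) (applyUpTo (λ k → suc (m + k)) m))
    ≡⟨ length-filter-++ (coprimeTo? mq) (applyUpTo suc m) _ ⟨
  length (filter (coprimeTo? mq) (applyUpTo suc m ++ applyUpTo (λ k → suc (m + k)) m))
    ≡⟨ cong (λ l → length (filter (coprimeTo? mq) l)) (applyUpTo-+ suc m m) ⟨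
  length (filter (coprimeTo? mq) (applyUpTo suc (m + m)))
    ≤⟨ length-filter-applyUpTo-mono (coprimeTo? mq) suc m+m≤mq ⟩
  length (filter (coprimeTo? mq) (applyUpTo suc mq))
    ≡⟨ φ≡length-filter-coprimeTo mq ⟨
  φ mq ∎
  where
  open ≤-Reasoning
  mq = m * q
  cover : ∀ k → gcd (suc k) m ≡ 1 → gcd (suc k) mq ≡ 1 ⊎ gcd (suc (m + k)) mq ≡ 1
  cover k gcd≡1 with coprime⇒coprime-*-prime {q} {m} {suc k} q-prime (gcd≡1⇒coprime gcd≡1)
  ... | inj₁ c = inj₁ (coprime⇒gcd≡1 c)
  ... | inj₂ c = inj₂ (coprime⇒gcd≡1 (subst (λ x → Coprime x mq) (+-suc m k) c))
  m+m≤mq : m + m ≤ mq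
  m+m≤mq = begin
    m + m  ≡⟨ cong (_+_ m) (+-identityʳ m) ⟨
    2 * m  ≡⟨ *-comm 2 m ⟩
    m * 2  ≤⟨ *-monoʳ-≤ m (nonTrivial⇒n>1 q {{prime⇒nonTrivial q-prime}}) ⟩
    mq     ∎

φ-*-product : ∀ m {qs} → All Prime qs → φ m ≤ φ (m * product qs)
φ-*-product m []                  = ≤-reflexive (cong φ (sym (*-identityʳ m)))
φ-*-product m {q ∷ qs} (q-prime ∷ qs-prime) = begin
  φ m                      ≤⟨ φ-*-prime q-prime m ⟩
  φ (m * q)                ≤⟨ φ-*-product (m * q) qs-prime ⟩
  φ (m * q * product qs)   ≡⟨ cong φ (*-assoc m q (product qs)) ⟩
  φ (m * (q * product qs)) ∎
  where open ≤-Reasoning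

φ-*-mono : ∀ m n .{{_ : NonZero n}} → φ m ≤ φ (m * n)
φ-*-mono m n = subst (λ k → φ m ≤ φ (m * k)) (sym isFactorisation) (φ-*-product m factorsPrime)
  where open PrimeFactorisation (factorise n)

frac-*-cancelʳ : ∀ a n g .{{_ : NonZero g}} → frac (a * g) (n * g) ≡ frac a n
frac-*-cancelʳ a zero    g       = refl
frac-*-cancelʳ a (suc n) (suc g) =
  fromℚᵘ-cong {mkℚᵘ (+ (a * suc g)) (g + n * suc g)} {mkℚᵘ (+ a) n} (*≡* (begin
    + (a * suc g) ℤ.* + suc n   ≡⟨ pos-* (a * suc g) (suc n) ⟨
    + (a * suc g * suc n)       ≡⟨ cong +_ (trans (*-assoc a (suc g) (suc n)) (cong (a *_) (*-comm (suc g) (suc n)))) ⟩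
    + (a * (suc n * suc g))     ≡⟨ pos-* a (suc n * suc g) ⟩
    + a ℤ.* + (suc n * suc g)   ∎))
  where open ≡-Reasoning

frac-/ : ∀ {g} a n .{{_ : NonZero g}} → g ∣ a → g ∣ n → frac a n ≡ frac (a / g) (n / g)
frac-/ {g} a n g∣a g∣n = begin
  frac a n                      ≡⟨ cong₂ frac (m/n*n≡m g∣a) (m/n*n≡m g∣n) ⟨
  frac (a / g * g) (n / g * g)  ≡⟨ frac-*-cancelʳ (a / g) (n / g) g ⟩
  frac (a / g) (n / g)          ∎
  where open ≡-Reasoning

lemma4p3 : (p B : ℕ) → Prime p → 0 < B → (j b : ℕ) → Ψ p B b
    → 1 ≤ j → j ≤ p ^ lp p * b → gcd j p ≡ 1
    → frac j (p ^ lp p * b) ∈𝒵[ p , B ]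
lemma4p3 p B _ _ j b (1≤b , φ[N]≤B) 1≤j j≤N gcd[j,p]≡1 =
  b / g , j / g , (1≤b/g , φ≤B) , m≥n⇒m/n>0 (∣⇒≤ g∣j) , j/g≤ , gcd≡1 , fraction
  where
  P = p ^ lp p
  N = P * b
  g = gcd j N
  instance
    _ : NonZero j
    _ = >-nonZero 1≤j
    _ : NonZero b
    _ = >-nonZero 1≤b
    _ : NonZero g
    _ = ≢-nonZero (gcd[m,n]≢0 j N (inj₁ (n>0⇒n≢0 1≤j)))
  g∣j : g ∣ j
  g∣j = gcd[m,n]∣m j N
  g∣N : g ∣ N
  g∣N = gcd[m,n]∣n j N
  g∣b : g ∣ b
  g∣b = coprime-divisor (∣∧coprime⇒coprime g∣j (coprime-^ (lp p) (gcd≡1⇒coprime gcd[j,p]≡1))) g∣N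
  N/g≡ : N / g ≡ P * (b / g)
  N/g≡ = *-/-assoc P g∣b
  1≤b/g : 1 ≤ b / g
  1≤b/g = m≥n⇒m/n>0 (∣⇒≤ g∣b)
  φ≤B : φ (P * (b / g)) ≤ B
  φ≤B = ≤-trans (φ-*-mono (P * (b / g)) g)
    (subst (λ k → φ k ≤ B) (trans (sym (m/n*n≡m g∣N)) (cong (_* g) N/g≡)) φ[N]≤B)
  j/g≤ : j / g ≤ P * (b / g)
  j/g≤ = subst (j / g ≤_) N/g≡ (/-monoˡ-≤ g j≤N)
  gcd≡1 : gcd (j / g) (P * (b / g)) ≡ 1
  gcd≡1 = coprime⇒gcd≡1 (subst (Coprime (j / g)) N/g≡ (coprime-/gcd j N))
  fraction : frac j N ≡ frac (j / g) (P * (b / g))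
  fraction = trans (frac-/ j N g∣j g∣N) (cong (frac (j / g)) N/g≡)
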